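{- (a) For the dihedral groups, $M(\mathbb{D}_{2k+1})=B_{3k+1}$ for $k\ge1$ and $M(\mathbb{D}_{2k})=B_{3k}$ for $k\ge2$. (b) For the dicyclic groups, $M(\mathbb{Q}_{4n})=B_{2n}$ for $n\ge2$. (c) For the quasidihedral groups, $M(Q\mathbb{D}_n^-)=B_{5\cdot 2^{n-3}}$ and $M(Q\mathbb{D}_n^+)=B_{2^{n-1}+1}$ for $n\ge4$.
   Context: For $n\ge3$, $\mathbb{D}_n=\langle a,b: a^n=b^2=e,\ bab=a^{ -1}\rangle$ is the dihedral group of order $2n$. For $n\ge2$, $\mathbb{Q}_{4n}=\langle a,b: a^{2n}=e,\ b^2=a^n,\ b^{ -1}ab=a^{ -1}\rangle$ is the dicyclic group of order $4n$. For $n\ge4$, $Q\mathbb{D}_n^{\pm}=\langle x,y: x^{2^{n-1}}=y^2=e,\ yxy=x^{2^{n-2}\pm1}\rangle$ are the quasidihedral groups of order $2^n$. For a finite group $G$, a metric $d$ is right-invariant if $d(gh,g'h)=d(g,g')$ for all $g,g',h$; its induced partition is the partition of $G$ into classes of $g\sim h\iff d(g,e)=d(h,e)$; two right-invariant metrics are $\mathcal{P}$-equivalent if they have the same induced partition; $M(G)$ is the number of $\mathcal{P}$-equivalence classes of right-invariant metrics on $G$. $B_m$ is the $m$-th Bell number.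
   Formalization: The right-invariant metrics on each group, whose $\mathcal{P}$-equivalence classes are counted by $M(G)$, take values in the rationals rather than in the reals. -}

module Defs where

open import Data.Nat using (ℕ; zero; suc; _+_; _*_; _∸_; _^_)
open import Data.Nat.DivMod using (_mod_)
open import Data.Fin using (Fin; toℕ) renaming (zero to fzero)
open import Data.Bool using (Bool; true; false; if_then_else_; _∧_; _xor_)
open import Data.Product using (Σ; ∃; _×_; _,_)
open import Data.Rational using (ℚ; 0ℚ; _≤_) renaming (_+_ to _+ℚ_)
open import Relation.Binary.PropositionalEquality using (_≡_)

record GroupData : Set₁ where
  field
    Carrier : Set
    _∙_     : Carrier → Carrier → Carrier
    e       : Carrier

-- Concrete models of the groups: elements x^i y^s (i ∈ ℤ/(suc m), s ∈ {0,1}),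
-- with  y x^j = x^(r j) y  and  y^2 = x^c.
--   (x^i y^s)(x^j y^t) = x^(i + r^s j + [s∧t] c) y^(s+t)

MCElt : ℕ → Set
MCElt m = Fin (suc m) × Bool

MC : (m r c : ℕ) → GroupData
MC m r c = record
  { Carrier = MCElt m
  ; _∙_ = mul
  ; e = (fzero , false)
  }
  where
  mul : MCElt m → MCElt m → MCElt m
  mul (i , s) (j , t) =
    ( (toℕ i + (if s then r * toℕ j else toℕ j) + (if s ∧ t then c else 0)) mod suc m
    , s xor t )

-- Dihedral group D_n = ⟨a,b : a^n = b^2 = e, bab = a^{-1}⟩ (order 2n; for n ≥ 1)
Dihedral : ℕ → GroupData
Dihedral n = MC (n ∸ 1) (n ∸ 1) 0

-- Dicyclic group Q_{4n} = ⟨a,b : a^{2n} = e, b^2 = a^n, b^{-1}ab = a^{-1}⟩ (order 4n; n ≥ 1)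
Dicyclic : ℕ → GroupData
Dicyclic n = MC (2 * n ∸ 1) (2 * n ∸ 1) n

-- Quasidihedral groups QD_n^± = ⟨x,y : x^{2^{n-1}} = y^2 = e, yxy = x^{2^{n-2} ± 1}⟩
QuasiDihedral⁺ : ℕ → GroupData
QuasiDihedral⁺ n = MC (2 ^ (n ∸ 1) ∸ 1) (2 ^ (n ∸ 2) + 1) 0

QuasiDihedral⁻ : ℕ → GroupData
QuasiDihedral⁻ n = MC (2 ^ (n ∸ 1) ∸ 1) (2 ^ (n ∸ 2) ∸ 1) 0

module _ (G : GroupData) where
  open GroupData G

  record IsRightInvariantMetric (d : Carrier → Carrier → ℚ) : Set where
    field
      nonneg     : ∀ g h → 0ℚ ≤ d g h
      zero⇒eq    : ∀ g h → d g h ≡ 0ℚ → g ≡ h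
      refl-zero  : ∀ g → d g g ≡ 0ℚ
      symmetric  : ∀ g h → d g h ≡ d h g
      triangle   : ∀ g h k → d g k ≤ d g h +ℚ d h k
      rightInv   : ∀ g g' h → d (g ∙ h) (g' ∙ h) ≡ d g g'

  RIMetric : Set
  RIMetric = Σ (Carrier → Carrier → ℚ) IsRightInvariantMetric

  InducedRel : RIMetric → Carrier → Carrier → Set
  InducedRel (d , _) g h = d g e ≡ d h e

  PEquiv : RIMetric → RIMetric → Set
  PEquiv d d' = ∀ g h → (InducedRel d g h → InducedRel d' g h)
                      × (InducedRel d' g h → InducedRel d g h)

  -- "M(G) = N": there are exactly N P-equivalence classes of right-invariant metrics,
  -- i.e. a family of N metrics meeting every class exactly once.
  M≡ : ℕ → Set
  M≡ N = Σ (Fin N → RIMetric) λ cls →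
           (∀ d → ∃ λ i → PEquiv d (cls i))
         × (∀ i j → PEquiv (cls i) (cls j) → i ≡ j)

S₂ : ℕ → ℕ → ℕ
S₂ zero    zero    = 1
S₂ zero    (suc k) = 0
S₂ (suc n) zero    = 0
S₂ (suc n) (suc k) = suc k * S₂ n (suc k) + S₂ n k

sumS₂ : ℕ → ℕ → ℕ
sumS₂ n zero    = S₂ n 0
sumS₂ n (suc j) = sumS₂ n j + S₂ n (suc j)

Bell : ℕ → ℕ
Bell n = sumS₂ n n

-- A right-invariant metric d is determined by its norm g ↦ d(g, e), which vanishes only at e and
-- takes the same value on g and g⁻¹; P-equivalence sees only the level sets of this norm. These
-- level sets therefore partition the K inverse pairs {g, g⁻¹} ≠ {e}, and every partition occurs:
-- giving the pairs in the j-th block the norm K + 1 + j puts all nonzero norms in [K + 1, 2K + 1],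
-- where the triangle inequality holds automatically. Hence M(G) = B_K.
--
-- Each of the groups consists of the elements x^i y^s (i mod M, s ∈ {0, 1}) with y x^j = x^(rj) y
-- and y² = x^c. The pairs {x^i, x^(-i)} contribute ⌊M/2⌋ to K, and the pairs {x^i y, x^(-r(i+c)) y}
-- are the orbits of the involution i ↦ -r(i+c) of ℤ/M. For each family this involution is built
-- from identities, half-swaps and mirror images by concatenation and interleaving, and each of these
-- operations comes with an explicit numbering of the orbits.
module Submission where

open import Algebra.Bundles using (Group)
open import Algebra.Structures using (IsGroup)
open import Data.Bool using (Bool; true; false; if_then_else_; _∧_; _xor_)
open import Data.Bool.Properties using (xor-assoc)
open import Data.Fin using (Fin; toℕ; fromℕ<)
open import Data.Fin.Patterns using (0F)
open import Data.Fin.Properties using (toℕ<n; toℕ-fromℕ<; toℕ-injective; +↔⊎; *↔×)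
import Data.Integer as ℤ
import Data.Integer.Properties as ℤ
open import Data.Nat using (ℕ; zero; suc; _+_; _*_; _∸_; _^_; _⊓_; _≤_; _<_; _%_; z≤n; s≤s; z<s; s<s)
open import Data.Nat.Divisibility using (_∣_; divides; n∣m⇒m%n≡0; m%n≡0⇒n∣m)
open import Data.Nat.DivMod
  using (_mod_; %-distribˡ-+; %-distribˡ-*; m%n%n≡m%n; [m+kn]%n≡m%n; m<n⇒m%n≡m; m%n<n)
open import Data.Nat.Properties
  using (≤-refl; ≤-reflexive; ≤-trans; ≤-<-trans; <-≤-trans; ≤-pred; ≤-irrelevant; <⇒≤; <⇒≢;
         <-irrefl; ≮⇒≥; ≤⇒≯; n≤1+n; m≤n⇒m≤1+n; m≤n⇒m<n∨m≡n; m≤m+n; m≤n+m; _<?_; anyUpTo?;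
         suc-injective; suc-pred; +-comm; +-assoc; +-suc; +-identityʳ; *-comm; *-zeroʳ;
         +-mono-≤; +-monoˡ-≤; +-monoʳ-≤; +-monoʳ-<; +-cancelˡ-≡; +-cancelˡ-<; m∸n≤m; m∸[m∸n]≡n;
         m+[n∸m]≡n; m+n∸n≡m; m+n≤o⇒m≤o∸n; m^n≢0; m⊓n≤m; m⊓n≤n; m≤n⇒m⊓n≡m; ⊓-comm; ⊓-idem; ⊓-sel)
open import Data.Nat.Tactic.RingSolver using (solve-∀)
open import Data.Product using (Σ; ∃; ∃₂; _×_; _,_; proj₁; proj₂)
open import Data.Product.Function.NonDependent.Propositional using (_×-↔_)
open import Data.Rational as ℚ using (ℚ; 0ℚ; ↥_; *≤*) renaming (_≟_ to _≟ℚ_)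
open import Data.Rational.Literals using (fromℤ)
open import Data.Rational.Properties using (toℚᵘ-cancel-≤; toℚᵘ-homo-+)
import Data.Rational.Unnormalised as ℚᵘ
import Data.Rational.Unnormalised.Properties as ℚᵘ
open import Data.Sum using (_⊎_; inj₁; inj₂)
import Data.Sum as Sum
open import Data.Sum.Function.Propositional using (_⊎-↔_)
open import Data.Unit using (tt)
open import Function using (_∘_)
open import Function.Bundles using (_↔_; _⇔_; mk↔ₛ′; mk⇔; Equivalence; Inverse; Injection)
open import Function.Construct.Composition using () renaming (equivalence to ⇔-trans)
open import Function.Construct.Symmetry using (⇔-sym)
open import Function.Properties.Inverse using (↔-refl; ↔-trans; Inverse⇒Injection)
open import Level using (0ℓ)
open import Relation.Binary.Bundles using (Setoid)
open import Relation.Binary.Definitions using (DecidableEquality)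
open import Relation.Binary.PropositionalEquality
  using (_≡_; _≢_; refl; sym; trans; cong; cong₂; subst; subst₂; isEquivalence; module ≡-Reasoning)
import Relation.Binary.Reasoning.Setoid
open import Relation.Binary.Structures using (IsEquivalence)
open import Relation.Nullary using (¬_; yes; no; contradiction)
open import Relation.Unary using (U)

open import Defs

SameKernelOn : {X A B : Set} → (X → Set) → (X → A) → (X → B) → Set
SameKernelOn P f g = ∀ x y → P x → P y → (f x ≡ f y) ⇔ (g x ≡ g y)

≡-cong-⇔ : {A : Set} {x x′ y y′ : A} → x ≡ x′ → y ≡ y′ → (x ≡ y) ⇔ (x′ ≡ y′)
≡-cong-⇔ refl refl = mk⇔ (λ p → p) (λ p → p)

≡-sym-⇔ : {A : Set} {x y : A} → (x ≡ y) ⇔ (y ≡ x)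
≡-sym-⇔ = mk⇔ sym sym

absurd-⇔ : {P Q : Set} → ¬ P → ¬ Q → P ⇔ Q
absurd-⇔ ¬p ¬q = mk⇔ (λ p → contradiction p ¬p) (λ q → contradiction q ¬q)

sameKernel-sym : {X A B : Set} {P : X → Set} {f : X → A} {g : X → B} →
                 SameKernelOn P f g → SameKernelOn P g f
sameKernel-sym same x y px py = ⇔-sym (same x y px py)

sameKernel-trans : {X A B C : Set} {P : X → Set} {f : X → A} {g : X → B} {h : X → C} →
                   SameKernelOn P f g → SameKernelOn P g h → SameKernelOn P f h
sameKernel-trans fg gh x y px py = ⇔-trans (fg x y px py) (gh x y px py)

sameKernel-injective : {X A B : Set} {P : X → Set} {f : X → A} {h : A → B} →
                       (∀ {a b} → h a ≡ h b → a ≡ b) → SameKernelOn P f (h ∘ f)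
sameKernel-injective {h = h} h-injective _ _ _ _ = mk⇔ (cong h) h-injective

sameKernel-tail : ∀ {n} {A B : Set} {f : ℕ → A} {g : ℕ → B} →
                  SameKernelOn (_< suc n) f g → SameKernelOn (_< n) (f ∘ suc) (g ∘ suc)
sameKernel-tail same x y x<n y<n = same (suc x) (suc y) (s≤s x<n) (s≤s y<n)

sameKernel-cons : ∀ {n} {A B : Set} {f : ℕ → A} {g : ℕ → B} →
                  (∀ {y} → y < n → (f 0 ≡ f (suc y)) ⇔ (g 0 ≡ g (suc y))) →
                  SameKernelOn (_< n) (f ∘ suc) (g ∘ suc) → SameKernelOn (_< suc n) f g
sameKernel-cons head tail zero    zero    _         _         = mk⇔ (λ _ → refl) (λ _ → refl)
sameKernel-cons head tail zero    (suc y) _         (s≤s y<n) = head y<n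
sameKernel-cons head tail (suc x) zero    (s≤s x<n) _         =
  ⇔-trans ≡-sym-⇔ (⇔-trans (head x<n) ≡-sym-⇔)
sameKernel-cons head tail (suc x) (suc y) (s≤s x<n) (s≤s y<n) = tail x y x<n y<n

-- A restricted growth string, outermost letter first: the outermost constructor places
-- point 0, either into one of the k blocks of the remaining points or into the new block k.
data Partition : ℕ → ℕ → Set where
  []       : Partition 0 0
  inBlock  : ∀ {n k} → Fin (suc k) → Partition n (suc k) → Partition (suc n) (suc k)
  newBlock : ∀ {n k} → Partition n k → Partition (suc n) (suc k)

block : ∀ {n k} → Partition n k → ℕ → ℕ
block []                   _       = 0
block (inBlock b w)        zero    = toℕ b
block (newBlock {k = k} w) zero    = k
block (inBlock b w)        (suc i) = block w i
block (newBlock w)         (suc i) = block w i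

block< : ∀ {n k} (w : Partition n k) {i} → i < n → block w i < k
block< (inBlock b w) {zero}  _         = toℕ<n b
block< (newBlock w)  {zero}  _         = ≤-refl
block< (inBlock b w) {suc i} (s≤s i<n) = block< w i<n
block< (newBlock w)  {suc i} (s≤s i<n) = m≤n⇒m≤1+n (block< w i<n)

blocks≤points : ∀ {n k} → Partition n k → k ≤ n
blocks≤points []            = z≤n
blocks≤points (inBlock _ w) = m≤n⇒m≤1+n (blocks≤points w)
blocks≤points (newBlock w)  = s≤s (blocks≤points w)

block-surjective : ∀ {n k} (w : Partition n k) {b} → b < k → ∃ λ i → i < n × block w i ≡ b
block-surjective (inBlock _ w) b<k with block-surjective w b<k
... | i , i<n , refl = suc i , s≤s i<n , refl
block-surjective (newBlock w) b<1+k with m≤n⇒m<n∨m≡n (≤-pred b<1+k)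
... | inj₂ refl = zero , s≤s z≤n , refl
... | inj₁ b<k with block-surjective w b<k
...   | i , i<n , refl = suc i , s≤s i<n , refl

kernel-unique : ∀ {n k l} (w : Partition n k) (v : Partition n l) →
                SameKernelOn (_< n) (block w) (block v) → _≡_ {A = Σ ℕ (Partition n)} (k , w) (l , v)
kernel-unique [] [] _ = refl
kernel-unique (inBlock b w) (inBlock c v) same
  with kernel-unique w v (sameKernel-tail same) | block-surjective w (toℕ<n b)
... | refl | i , i<n , wi≡b =
  cong (λ b → _ , inBlock b w) (toℕ-injective (sym (trans c≡wi wi≡b)))
  where c≡wi = Equivalence.to (same 0 (suc i) z<s (s<s i<n)) (sym wi≡b)
kernel-unique (inBlock b w) (newBlock v) same with block-surjective w (toℕ<n b)
... | i , i<n , wi≡b = contradiction l≡vi (<⇒≢ (block< v i<n) ∘ sym)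
  where l≡vi = Equivalence.to (same 0 (suc i) z<s (s<s i<n)) (sym wi≡b)
kernel-unique (newBlock w) (inBlock c v) same with block-surjective v (toℕ<n c)
... | i , i<n , vi≡c = contradiction k≡wi (<⇒≢ (block< w i<n) ∘ sym)
  where k≡wi = Equivalence.from (same 0 (suc i) z<s (s<s i<n)) (sym vi≡c)
kernel-unique (newBlock w) (newBlock v) same with kernel-unique w v (sameKernel-tail same)
... | refl = refl

kernelPartition : {A : Set} → DecidableEquality A → ∀ n (f : ℕ → A) →
                  ∃₂ λ k (w : Partition n k) → SameKernelOn (_< n) (block w) f
kernelPartition _≟_ zero    f = 0 , [] , λ _ _ ()
kernelPartition _≟_ (suc n) f
  with kernelPartition _≟_ n (f ∘ suc) | anyUpTo? (λ i → f 0 ≟ f (suc i)) n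
... | zero , w , same | yes (i , i<n , _) = contradiction (block< w i<n) λ ()
... | suc k , w , same | yes (i , i<n , f0≡fi) =
  suc k , inBlock b w , sameKernel-cons head same
  where
  b = fromℕ< (block< w i<n)
  head : ∀ {y} → y < n → (toℕ b ≡ block w y) ⇔ (f 0 ≡ f (suc y))
  head {y} y<n = ⇔-trans (≡-cong-⇔ (toℕ-fromℕ< (block< w i<n)) refl)
               (⇔-trans (same i y i<n y<n) (≡-cong-⇔ (sym f0≡fi) refl))
... | k , w , same | no ¬f0≡f = suc k , newBlock w , sameKernel-cons head same
  where
  head : ∀ {y} → y < n → (k ≡ block w y) ⇔ (f 0 ≡ f (suc y))
  head {y} y<n = absurd-⇔ (<⇒≢ (block< w y<n) ∘ sym) (λ f0≡fy → ¬f0≡f (y , y<n , f0≡fy))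

insertPoint↔ : ∀ {n k} →
               ((Fin (suc k) × Partition n (suc k)) ⊎ Partition n k) ↔ Partition (suc n) (suc k)
insertPoint↔ = mk↔ₛ′ insert remove insert∘remove remove∘insert
  where
  insert : _ → Partition _ _
  insert (inj₁ (b , w)) = inBlock b w
  insert (inj₂ w)       = newBlock w
  remove : Partition _ _ → _
  remove (inBlock b w) = inj₁ (b , w)
  remove (newBlock w)  = inj₂ w
  insert∘remove : ∀ w → insert (remove w) ≡ w
  insert∘remove (inBlock b w) = refl
  insert∘remove (newBlock w)  = refl
  remove∘insert : ∀ x → remove (insert x) ≡ x
  remove∘insert (inj₁ _) = refl
  remove∘insert (inj₂ _) = refl

S₂↔Partition : ∀ n k → Fin (S₂ n k) ↔ Partition n k
S₂↔Partition zero    zero    =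
  mk↔ₛ′ (λ _ → []) (λ _ → 0F) (λ { [] → refl }) (λ { 0F → refl ; (Fin.suc ()) })
S₂↔Partition zero    (suc k) = mk↔ₛ′ (λ ()) (λ ()) (λ ()) (λ ())
S₂↔Partition (suc n) zero    = mk↔ₛ′ (λ ()) (λ ()) (λ ()) (λ ())
S₂↔Partition (suc n) (suc k) =
  ↔-trans +↔⊎ (↔-trans (intoOldBlock ⊎-↔ S₂↔Partition n k) insertPoint↔)
  where
  intoOldBlock : Fin (suc k * S₂ n (suc k)) ↔ (Fin (suc k) × Partition n (suc k))
  intoOldBlock = ↔-trans *↔× (↔-refl ×-↔ S₂↔Partition n (suc k))

Σ≤0↔ : {P : ℕ → Set} → P 0 ↔ (Σ ℕ λ k → k ≤ 0 × P k)
Σ≤0↔ = mk↔ₛ′ (λ x → 0 , z≤n , x) (λ { (0 , z≤n , x) → x }) (λ { (0 , z≤n , x) → refl }) λ _ → refl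

Σ≤suc↔ : {P : ℕ → Set} (j : ℕ) →
         ((Σ ℕ λ k → k ≤ j × P k) ⊎ P (suc j)) ↔ (Σ ℕ λ k → k ≤ suc j × P k)
Σ≤suc↔ {P} j = mk↔ₛ′ to from to∘from from∘to
  where
  to : (Σ ℕ λ k → k ≤ j × P k) ⊎ P (suc j) → Σ ℕ λ k → k ≤ suc j × P k
  to (inj₁ (k , k≤j , x)) = k , m≤n⇒m≤1+n k≤j , x
  to (inj₂ x)             = suc j , ≤-refl , x
  from-split : ∀ {k} → k < suc j ⊎ k ≡ suc j → P k → (Σ ℕ λ k → k ≤ j × P k) ⊎ P (suc j)
  from-split (inj₁ k<1+j) x = inj₁ (_ , ≤-pred k<1+j , x)
  from-split (inj₂ refl)  x = inj₂ x
  from : (Σ ℕ λ k → k ≤ suc j × P k) → (Σ ℕ λ k → k ≤ j × P k) ⊎ P (suc j)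
  from (k , k≤1+j , x) = from-split (m≤n⇒m<n∨m≡n k≤1+j) x
  to∘from : ∀ y → to (from y) ≡ y
  to∘from (k , k≤1+j , x) with m≤n⇒m<n∨m≡n k≤1+j
  ... | inj₁ _    = cong (λ p → k , p , x) (≤-irrelevant _ _)
  ... | inj₂ refl = cong (λ p → k , p , x) (≤-irrelevant _ _)
  from∘to : ∀ x → from (to x) ≡ x
  from∘to (inj₁ (k , k≤j , x)) with m≤n⇒m<n∨m≡n (m≤n⇒m≤1+n k≤j)
  ... | inj₁ _    = cong (λ p → inj₁ (k , p , x)) (≤-irrelevant _ _)
  ... | inj₂ refl = contradiction k≤j (<-irrefl refl)
  from∘to (inj₂ x) with m≤n⇒m<n∨m≡n (≤-refl {suc j})
  ... | inj₁ 1+j<1+j = contradiction 1+j<1+j (<-irrefl refl)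
  ... | inj₂ refl    = refl

sumS₂↔Partition : ∀ n j → Fin (sumS₂ n j) ↔ (Σ ℕ λ k → k ≤ j × Partition n k)
sumS₂↔Partition n zero    = ↔-trans (S₂↔Partition n 0) Σ≤0↔
sumS₂↔Partition n (suc j) =
  ↔-trans +↔⊎ (↔-trans (sumS₂↔Partition n j ⊎-↔ S₂↔Partition n (suc j)) (Σ≤suc↔ j))

Bell↔Partition : ∀ n → Fin (Bell n) ↔ Σ ℕ (Partition n)
Bell↔Partition n = ↔-trans (sumS₂↔Partition n n) (mk↔ₛ′ forget bound forget∘bound bound∘forget)
  where
  forget : (Σ ℕ λ k → k ≤ n × Partition n k) → Σ ℕ (Partition n)
  forget (k , _ , w) = k , w
  bound : Σ ℕ (Partition n) → Σ ℕ λ k → k ≤ n × Partition n k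
  bound (k , w) = k , blocks≤points w , w
  forget∘bound : ∀ w → forget (bound w) ≡ w
  forget∘bound _ = refl
  bound∘forget : ∀ w → bound (forget w) ≡ w
  bound∘forget (k , k≤n , w) = cong (λ p → k , p , w) (≤-irrelevant _ _)

record Orbits {A : Set} (P : A → Set) (σ : A → A) (K : ℕ) : Set where
  field
    σ-closed  : ∀ x → P x → P (σ x)
    label     : A → ℕ
    label<    : ∀ x → P x → label x < K
    label-σ   : ∀ x → P x → label (σ x) ≡ label x
    rep       : ℕ → A
    rep-∈     : ∀ c → c < K → P (rep c)
    label-rep : ∀ c → c < K → label (rep c) ≡ c
    rep-label : ∀ x → P x → rep (label x) ≡ x ⊎ rep (label x) ≡ σ x

transfer : ∀ {A P} {σ τ : A → A} {K} → Orbits P σ K → (∀ x → P x → σ x ≡ τ x) → Orbits P τ K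
transfer {P = P} O σ≗τ = record
  { σ-closed  = λ x px → subst P (σ≗τ x px) (σ-closed x px)
  ; label     = label
  ; label<    = label<
  ; label-σ   = λ x px → trans (cong label (sym (σ≗τ x px))) (label-σ x px)
  ; rep       = rep
  ; rep-∈     = rep-∈
  ; label-rep = label-rep
  ; rep-label = λ x px → Sum.map₂ (λ rep≡σx → trans rep≡σx (σ≗τ x px)) (rep-label x px)
  }
  where open Orbits O

-- When the least elements of the orbits are exactly 0, …, K − 1, they serve as labels.
min-orbits : ∀ {M K} {σ : ℕ → ℕ} → (∀ i → i < M → σ i < M) → (∀ i → i < M → σ (σ i) ≡ i) →
             (∀ i → i < M → i ⊓ σ i < K) → (∀ c → c < K → c < M × c ≤ σ c) → Orbits (_< M) σ K
min-orbits {σ = σ} closed involutive min<K least = record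
  { σ-closed  = closed
  ; label     = λ i → i ⊓ σ i
  ; label<    = min<K
  ; label-σ   = λ i i<M → trans (cong (σ i ⊓_) (involutive i i<M)) (⊓-comm (σ i) i)
  ; rep       = λ c → c
  ; rep-∈     = λ c c<K → proj₁ (least c c<K)
  ; label-rep = λ c c<K → m≤n⇒m⊓n≡m (proj₂ (least c c<K))
  ; rep-label = λ i _ → ⊓-sel i (σ i)
  }

identity-orbits : ∀ M → Orbits (_< M) (λ i → i) M
identity-orbits M = min-orbits (λ _ i<M → i<M) (λ _ _ → refl)
  (λ i i<M → subst (_< M) (sym (⊓-idem i)) i<M) (λ _ c<M → c<M , ≤-refl)

⊓<-half : ∀ a b K → a + b < K + K → a ⊓ b < K
⊓<-half a b K a+b<2K with a <? K
... | yes a<K = ≤-<-trans (m⊓n≤m a b) a<K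
... | no  a≮K = ≤-<-trans (m⊓n≤n a b) (+-cancelˡ-< K b K (≤-<-trans (+-monoˡ-≤ b (≮⇒≥ a≮K)) a+b<2K))

mirror-orbits : ∀ L K → L ≡ K + K ⊎ suc L ≡ K + K → Orbits (_< L) (λ i → L ∸ suc i) K
mirror-orbits L K L≈2K = min-orbits closed involutive min<K least
  where
  L≤2K : L ≤ K + K
  L≤2K = Sum.[ ≤-reflexive , (λ 1+L≡2K → ≤-trans (n≤1+n L) (≤-reflexive 1+L≡2K)) ]′ L≈2K
  2K≤1+L : K + K ≤ suc L
  2K≤1+L = Sum.[ (λ L≡2K → ≤-trans (≤-reflexive (sym L≡2K)) (n≤1+n L)) , ≤-reflexive ∘ sym ]′ L≈2K
  closed : ∀ i → i < L → L ∸ suc i < L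
  closed i (s≤s {n = n} i≤n) = s≤s (m∸n≤m n i)
  involutive : ∀ i → i < L → L ∸ suc (L ∸ suc i) ≡ i
  involutive i (s≤s i≤n) = m∸[m∸n]≡n i≤n
  min<K : ∀ i → i < L → i ⊓ (L ∸ suc i) < K
  min<K i i<L = ⊓<-half i (L ∸ suc i) K (<-≤-trans (≤-reflexive (m+[n∸m]≡n i<L)) L≤2K)
  least : ∀ c → c < K → c < L × c ≤ L ∸ suc c
  least c c<K = ≤-trans (m≤n+m (suc c) c) c+1+c≤L , m+n≤o⇒m≤o∸n c c+1+c≤L
    where
    c+1+c≤L : c + suc c ≤ L
    c+1+c≤L = ≤-pred (≤-trans (+-mono-≤ c<K c<K) 2K≤1+L)

data Split (T : ℕ) : ℕ → Set where
  below : ∀ {i} → i < T → Split T i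
  above : ∀ j → Split T (T + j)

split : ∀ T i → Split T i
split zero    i       = above i
split (suc T) zero    = below z<s
split (suc T) (suc i) with split T i
... | below i<T = below (s<s i<T)
... | above j   = above j

split-below : ∀ {T i} (i<T : i < T) → split T i ≡ below i<T
split-below {suc T} {zero}  z<s       = refl
split-below {suc T} {suc i} (s<s i<T) rewrite split-below i<T = refl

split-above : ∀ T j → split T (T + j) ≡ above j
split-above zero    j = refl
split-above (suc T) j rewrite split-above T j = refl

above< : ∀ T {j U} → T + j < T + U → j < U
above< T {j} {U} = +-cancelˡ-< T j U

halfSwap : ℕ → ℕ → ℕ
halfSwap T i with split T i
... | below _ = T + i
... | above j = j

halfSwap-orbits : ∀ T → Orbits (_< T + T) (halfSwap T) T
halfSwap-orbits T = min-orbits closed involutive min<T least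
  where
  closed : ∀ i → i < T + T → halfSwap T i < T + T
  closed i i<2T with split T i
  ... | below i<T = +-monoʳ-< T i<T
  ... | above j   = ≤-trans (above< T i<2T) (m≤m+n T T)
  involutive : ∀ i → i < T + T → halfSwap T (halfSwap T i) ≡ i
  involutive i i<2T with split T i
  ... | below i<T rewrite split-above T i = refl
  ... | above j   rewrite split-below (above< T i<2T) = refl
  min<T : ∀ i → i < T + T → i ⊓ halfSwap T i < T
  min<T i i<2T with split T i
  ... | below i<T = ≤-<-trans (m⊓n≤m i (T + i)) i<T
  ... | above j   = ≤-<-trans (m⊓n≤n (T + j) j) (above< T i<2T)
  least : ∀ c → c < T → c < T + T × c ≤ halfSwap T c
  least c c<T rewrite split-below c<T = ≤-trans c<T (m≤m+n T T) , m≤n+m c T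

concat : ℕ → (ℕ → ℕ) → (ℕ → ℕ) → ℕ → ℕ
concat T σ τ i with split T i
... | below _ = σ i
... | above j = T + τ j

concat-orbits : ∀ {T U K L σ τ} → Orbits (_< T) σ K → Orbits (_< U) τ L →
                Orbits (_< T + U) (concat T σ τ) (K + L)
concat-orbits {T} {U} {K} {L} {σ} {τ} A B = record
  { σ-closed  = σ-closed
  ; label     = label
  ; label<    = label<
  ; label-σ   = label-σ
  ; rep       = rep
  ; rep-∈     = rep-∈
  ; label-rep = label-rep
  ; rep-label = rep-label
  }
  where
  module A = Orbits A
  module B = Orbits B

  label : ℕ → ℕ
  label i with split T i
  ... | below _ = A.label i
  ... | above j = K + B.label j

  rep : ℕ → ℕ
  rep c with split K c
  ... | below _ = A.rep c
  ... | above j = T + B.rep j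

  σ-closed : ∀ i → i < T + U → concat T σ τ i < T + U
  σ-closed i i<T+U with split T i
  ... | below i<T = ≤-trans (A.σ-closed i i<T) (m≤m+n T U)
  ... | above j   = +-monoʳ-< T (B.σ-closed j (above< T i<T+U))

  label< : ∀ i → i < T + U → label i < K + L
  label< i i<T+U with split T i
  ... | below i<T = ≤-trans (A.label< i i<T) (m≤m+n K L)
  ... | above j   = +-monoʳ-< K (B.label< j (above< T i<T+U))

  label-σ : ∀ i → i < T + U → label (concat T σ τ i) ≡ label i
  label-σ i i<T+U with split T i
  ... | below i<T rewrite split-below (A.σ-closed i i<T) = A.label-σ i i<T
  ... | above j   rewrite split-above T (τ j) = cong (K +_) (B.label-σ j (above< T i<T+U))

  rep-∈ : ∀ c → c < K + L → rep c < T + U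
  rep-∈ c c<K+L with split K c
  ... | below c<K = ≤-trans (A.rep-∈ c c<K) (m≤m+n T U)
  ... | above j   = +-monoʳ-< T (B.rep-∈ j (above< K c<K+L))

  label-rep : ∀ c → c < K + L → label (rep c) ≡ c
  label-rep c c<K+L with split K c
  ... | below c<K rewrite split-below (A.rep-∈ c c<K) = A.label-rep c c<K
  ... | above j   rewrite split-above T (B.rep j) = cong (K +_) (B.label-rep j (above< K c<K+L))

  rep-label : ∀ i → i < T + U → rep (label i) ≡ i ⊎ rep (label i) ≡ concat T σ τ i
  rep-label i i<T+U with split T i
  ... | below i<T rewrite split-below (A.label< i i<T) = A.rep-label i i<T
  ... | above j   rewrite split-above K (B.label j) =
    Sum.map (cong (T +_)) (cong (T +_)) (B.rep-label j (above< T i<T+U))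

double : ℕ → ℕ
double zero    = zero
double (suc h) = suc (suc (double h))

double≡+ : ∀ h → double h ≡ h + h
double≡+ zero    = refl
double≡+ (suc h) = cong suc (trans (cong suc (double≡+ h)) (sym (+-suc h h)))

data Parity : ℕ → Set where
  even : ∀ h → Parity (double h)
  odd  : ∀ h → Parity (suc (double h))

parity : ∀ i → Parity i
parity zero          = even 0
parity (suc zero)    = odd 0
parity (suc (suc i)) with parity i
... | even h = even (suc h)
... | odd h  = odd (suc h)

parity-even : ∀ h → parity (double h) ≡ even h
parity-even zero    = refl
parity-even (suc h) rewrite parity-even h = refl

parity-odd : ∀ h → parity (suc (double h)) ≡ odd h
parity-odd zero    = refl
parity-odd (suc h) rewrite parity-odd h = refl

odd< : ∀ {h T} → h < T → suc (double h) < T + T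
odd< {h} {T} h<T = subst (_≤ T + T) (sym (double≡+ (suc h))) (+-mono-≤ h<T h<T)

even< : ∀ {h T} → h < T → double h < T + T
even< h<T = ≤-<-trans (n≤1+n _) (odd< h<T)

even<⁻¹ : ∀ {h T} → double h < T + T → h < T
even<⁻¹ {h} {T} 2h<2T with h <? T
... | yes h<T = h<T
... | no  h≮T =
  contradiction 2h<2T (≤⇒≯ (subst (T + T ≤_) (sym (double≡+ h)) (+-mono-≤ (≮⇒≥ h≮T) (≮⇒≥ h≮T))))

odd<⁻¹ : ∀ {h T} → suc (double h) < T + T → h < T
odd<⁻¹ 2h+1<2T = even<⁻¹ (≤-<-trans (n≤1+n _) 2h+1<2T)

interleave : (ℕ → ℕ) → (ℕ → ℕ) → ℕ → ℕ
interleave σ τ i with parity i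
... | even h = double (σ h)
... | odd h  = suc (double (τ h))

interleave-orbits : ∀ {T K L σ τ} → Orbits (_< T) σ K → Orbits (_< T) τ L →
                    Orbits (_< T + T) (interleave σ τ) (K + L)
interleave-orbits {T} {K} {L} {σ} {τ} A B = record
  { σ-closed  = σ-closed
  ; label     = label
  ; label<    = label<
  ; label-σ   = label-σ
  ; rep       = rep
  ; rep-∈     = rep-∈
  ; label-rep = label-rep
  ; rep-label = rep-label
  }
  where
  module A = Orbits A
  module B = Orbits B

  label : ℕ → ℕ
  label i with parity i
  ... | even h = A.label h
  ... | odd h  = K + B.label h

  rep : ℕ → ℕ
  rep c with split K c
  ... | below _ = double (A.rep c)
  ... | above j = suc (double (B.rep j))

  σ-closed : ∀ i → i < T + T → interleave σ τ i < T + T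
  σ-closed i i<2T with parity i
  ... | even h = even< (A.σ-closed h (even<⁻¹ i<2T))
  ... | odd h  = odd< (B.σ-closed h (odd<⁻¹ i<2T))

  label< : ∀ i → i < T + T → label i < K + L
  label< i i<2T with parity i
  ... | even h = ≤-trans (A.label< h (even<⁻¹ i<2T)) (m≤m+n K L)
  ... | odd h  = +-monoʳ-< K (B.label< h (odd<⁻¹ i<2T))

  label-σ : ∀ i → i < T + T → label (interleave σ τ i) ≡ label i
  label-σ i i<2T with parity i
  ... | even h rewrite parity-even (σ h) = A.label-σ h (even<⁻¹ i<2T)
  ... | odd h  rewrite parity-odd (τ h)  = cong (K +_) (B.label-σ h (odd<⁻¹ i<2T))

  rep-∈ : ∀ c → c < K + L → rep c < T + T
  rep-∈ c c<K+L with split K c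
  ... | below c<K = even< (A.rep-∈ c c<K)
  ... | above j   = odd< (B.rep-∈ j (above< K c<K+L))

  label-rep : ∀ c → c < K + L → label (rep c) ≡ c
  label-rep c c<K+L with split K c
  ... | below c<K rewrite parity-even (A.rep c) = A.label-rep c c<K
  ... | above j   rewrite parity-odd (B.rep j)  = cong (K +_) (B.label-rep j (above< K c<K+L))

  rep-label : ∀ i → i < T + T → rep (label i) ≡ i ⊎ rep (label i) ≡ interleave σ τ i
  rep-label i i<2T with parity i
  ... | even h rewrite split-below (A.label< h (even<⁻¹ i<2T)) =
    Sum.map (cong double) (cong double) (A.rep-label h (even<⁻¹ i<2T))
  ... | odd h  rewrite split-above K (B.label h) =
    Sum.map (cong (suc ∘ double)) (cong (suc ∘ double)) (B.rep-label h (odd<⁻¹ i<2T))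

ι : ℕ → ℚ
ι n = fromℤ (ℤ.+ n)

ι-injective : ∀ {m n} → ι m ≡ ι n → m ≡ n
ι-injective eq = cong (λ q → ℤ.∣ ↥ q ∣) eq

ι-nonNegative : ∀ n → 0ℚ ℚ.≤ ι n
ι-nonNegative n = *≤* (subst (ℤ.+ 0 ℤ.≤_) (sym (ℤ.*-identityʳ (ℤ.+ n))) (ℤ.+≤+ z≤n))

ι-mono-≤-+ : ∀ {a b c} → a ≤ b + c → ι a ℚ.≤ ι b ℚ.+ ι c
ι-mono-≤-+ {a} {b} {c} a≤b+c =
  toℚᵘ-cancel-≤ (ℚᵘ.≤-respʳ-≃ (ℚᵘ.≃-sym (toℚᵘ-homo-+ (ι b) (ι c))) (ℚᵘ.*≤* cross))
  where
  cross : ℤ.+ a ℤ.* ℤ.+ 1 ℤ.≤ (ℤ.+ b ℤ.* ℤ.+ 1 ℤ.+ ℤ.+ c ℤ.* ℤ.+ 1) ℤ.* ℤ.+ 1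
  cross = subst₂ ℤ._≤_ (sym (ℤ.*-identityʳ (ℤ.+ a)))
            (sym (trans (ℤ.*-identityʳ _) (cong₂ ℤ._+_ (ℤ.*-identityʳ (ℤ.+ b)) (ℤ.*-identityʳ (ℤ.+ c)))))
            (ℤ.+≤+ a≤b+c)

module RightInvariantMetrics (G : GroupData) (_⁻¹ : GroupData.Carrier G → GroupData.Carrier G)
                             (isGroup : IsGroup _≡_ (GroupData._∙_ G) (GroupData.e G) _⁻¹) where

  open GroupData G renaming (_∙_ to infixl 7 _∙_)
  open IsGroup isGroup using (_//_; assoc; identityˡ; identityʳ; inverseˡ; inverseʳ)

  group : Group 0ℓ 0ℓ
  group = record { isGroup = isGroup }

  open import Algebra.Properties.Group group using (ε⁻¹≈ε; x∙y⁻¹≈ε⇒x≈y; ⁻¹-anti-homo-∙; ⁻¹-anti-homo-//)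
  open ≡-Reasoning

  //-identityʳ : ∀ g → g // e ≡ g
  //-identityʳ g = trans (cong (g ∙_) ε⁻¹≈ε) (identityʳ g)

  //-∙-// : ∀ g h k → (g // h) ∙ (h // k) ≡ g // k
  //-∙-// g h k = begin
    (g ∙ h ⁻¹) ∙ (h ∙ k ⁻¹)  ≡⟨ assoc g (h ⁻¹) (h ∙ k ⁻¹) ⟩
    g ∙ (h ⁻¹ ∙ (h ∙ k ⁻¹))  ≡⟨ cong (g ∙_) (assoc (h ⁻¹) h (k ⁻¹)) ⟨
    g ∙ ((h ⁻¹ ∙ h) ∙ k ⁻¹)  ≡⟨ cong (λ x → g ∙ (x ∙ k ⁻¹)) (inverseˡ h) ⟩
    g ∙ (e ∙ k ⁻¹)           ≡⟨ cong (g ∙_) (identityˡ (k ⁻¹)) ⟩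
    g ∙ k ⁻¹                 ∎

  ∙-//-cancelʳ : ∀ g h k → (g ∙ k) // (h ∙ k) ≡ g // h
  ∙-//-cancelʳ g h k = begin
    (g ∙ k) ∙ (h ∙ k) ⁻¹      ≡⟨ cong ((g ∙ k) ∙_) (⁻¹-anti-homo-∙ h k) ⟩
    (g ∙ k) ∙ (k ⁻¹ ∙ h ⁻¹)   ≡⟨ assoc (g ∙ k) (k ⁻¹) (h ⁻¹) ⟨
    ((g ∙ k) ∙ k ⁻¹) ∙ h ⁻¹   ≡⟨ cong (_∙ h ⁻¹) (assoc g k (k ⁻¹)) ⟩
    (g ∙ (k ∙ k ⁻¹)) ∙ h ⁻¹   ≡⟨ cong (λ x → (g ∙ x) ∙ h ⁻¹) (inverseʳ k) ⟩
    (g ∙ e) ∙ h ⁻¹            ≡⟨ cong (_∙ h ⁻¹) (identityʳ g) ⟩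
    g ∙ h ⁻¹                  ∎

  record IsNorm (ℓ : Carrier → ℕ) : Set where
    field
      ≡0⇒e         : ∀ g → ℓ g ≡ 0 → g ≡ e
      e≡0          : ℓ e ≡ 0
      ⁻¹-invariant : ∀ g → ℓ (g ⁻¹) ≡ ℓ g
      subadditive  : ∀ g h → ℓ (g ∙ h) ≤ ℓ g + ℓ h

  normMetric : (ℓ : Carrier → ℕ) → IsNorm ℓ → RIMetric G
  normMetric ℓ isNorm = dist , record
    { nonneg    = λ g h → ι-nonNegative (ℓ (g // h))
    ; zero⇒eq   = λ g h d≡0 → x∙y⁻¹≈ε⇒x≈y g h (≡0⇒e (g // h) (ι-injective d≡0))
    ; refl-zero = λ g → cong ι (trans (cong ℓ (inverseʳ g)) e≡0)
    ; symmetric = λ g h → cong ι (trans (sym (⁻¹-invariant (g // h))) (cong ℓ (⁻¹-anti-homo-// g h)))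
    ; triangle  = λ g h k →
        ι-mono-≤-+ {ℓ (g // k)} {ℓ (g // h)} {ℓ (h // k)}
          (subst (λ x → ℓ x ≤ ℓ (g // h) + ℓ (h // k)) (//-∙-// g h k) (subadditive (g // h) (h // k)))
    ; rightInv  = λ g h k → cong (ι ∘ ℓ) (∙-//-cancelʳ g h k)
    }
    where
    open IsNorm isNorm
    dist : Carrier → Carrier → ℚ
    dist g h = ι (ℓ (g // h))

  banded⇒subadditive : ∀ (ℓ : Carrier → ℕ) K → (∀ g → ℓ g ≡ 0 → g ≡ e) →
                       (∀ g → ℓ g ≡ 0 ⊎ K ≤ ℓ g) → (∀ g → ℓ g ≤ K + K) →
                       ∀ g h → ℓ (g ∙ h) ≤ ℓ g + ℓ h
  banded⇒subadditive ℓ K ≡0⇒e zero-or-≥K ≤2K g h with zero-or-≥K g | zero-or-≥K h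
  ... | inj₁ ℓg≡0 | _ with ≡0⇒e g ℓg≡0
  ...   | refl = ≤-trans (≤-reflexive (cong ℓ (identityˡ h))) (m≤n+m (ℓ h) (ℓ e))
  banded⇒subadditive ℓ K ≡0⇒e _ ≤2K g h | inj₂ _ | inj₁ ℓh≡0 with ≡0⇒e h ℓh≡0
  ...   | refl = ≤-trans (≤-reflexive (cong ℓ (identityʳ g))) (m≤m+n (ℓ g) (ℓ e))
  banded⇒subadditive ℓ K ≡0⇒e _ ≤2K g h | inj₂ K≤ℓg | inj₂ K≤ℓh =
    ≤-trans (≤2K (g ∙ h)) (+-mono-≤ K≤ℓg K≤ℓh)

  norm : RIMetric G → Carrier → ℚ
  norm (d , _) g = d g e

  normMetric-norm : ∀ ℓ (isNorm : IsNorm ℓ) g → norm (normMetric ℓ isNorm) g ≡ ι (ℓ g)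
  normMetric-norm ℓ _ g = cong (ι ∘ ℓ) (//-identityʳ g)

  module _ (d : RIMetric G) where
    open IsRightInvariantMetric (proj₂ d)

    norm-⁻¹ : ∀ g → norm d (g ⁻¹) ≡ norm d g
    norm-⁻¹ g = begin
      proj₁ d (g ⁻¹) e                ≡⟨ rightInv (g ⁻¹) e g ⟨
      proj₁ d (g ⁻¹ ∙ g) (e ∙ g)      ≡⟨ cong (λ x → proj₁ d x (e ∙ g)) (inverseˡ g) ⟩
      proj₁ d e (e ∙ g)               ≡⟨ cong (proj₁ d e) (identityˡ g) ⟩
      proj₁ d e g                     ≡⟨ symmetric e g ⟩
      proj₁ d g e                     ∎

  PEquiv⇔sameKernel : ∀ d d′ → PEquiv G d d′ ⇔ SameKernelOn U (norm d) (norm d′)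
  PEquiv⇔sameKernel d d′ = mk⇔
    (λ P g h _ _ → mk⇔ (proj₁ (P g h)) (proj₂ (P g h)))
    (λ same g h → Equivalence.to (same g h tt tt) , Equivalence.from (same g h tt tt))

  module Classification {N : ℕ} (O : Orbits U _⁻¹ (suc N))
                        (label≡0⇒e : ∀ g → Orbits.label O g ≡ 0 → g ≡ e)
                        (label-e : Orbits.label O e ≡ 0) where

    open Orbits O

    weight : ∀ {k} → Partition N k → ℕ → ℕ
    weight w zero    = 0
    weight w (suc c) = suc (N + block w c)

    module _ {k} (w : Partition N k) where

      weight≡0⇒e : ∀ g → weight w (label g) ≡ 0 → g ≡ e
      weight≡0⇒e g ℓg≡0 with label g in label≡ℓ
      weight≡0⇒e g refl | zero = label≡0⇒e g label≡ℓ

      weight-zero-or-≥ : ∀ c → weight w c ≡ 0 ⊎ suc N ≤ weight w c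
      weight-zero-or-≥ zero    = inj₁ refl
      weight-zero-or-≥ (suc c) = inj₂ (s≤s (m≤m+n N (block w c)))

      weight≤ : ∀ c → c < suc N → weight w c ≤ suc N + suc N
      weight≤ zero    _         = z≤n
      weight≤ (suc c) (s≤s c<N) =
        s≤s (+-monoʳ-≤ N (m≤n⇒m≤1+n (<⇒≤ (≤-trans (block< w c<N) (blocks≤points w)))))

      weight-isNorm : IsNorm (weight w ∘ label)
      weight-isNorm = record
        { ≡0⇒e         = weight≡0⇒e
        ; e≡0          = cong (weight w) label-e
        ; ⁻¹-invariant = λ g → cong (weight w) (label-σ g tt)
        ; subadditive  = banded⇒subadditive (weight w ∘ label) (suc N) weight≡0⇒e
            (λ g → weight-zero-or-≥ (label g)) (λ g → weight≤ (label g) (label< g tt))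
        }

      block∼weight : SameKernelOn (_< N) (block w) (ι ∘ weight w ∘ suc)
      block∼weight = sameKernel-injective {P = _< N} {f = block w}
                       (λ eq → +-cancelˡ-≡ N _ _ (suc-injective (ι-injective eq)))

    metricOf : Σ ℕ (Partition N) → RIMetric G
    metricOf (k , w) = normMetric (weight w ∘ label) (weight-isNorm w)

    -- A record rather than a bare equation, so that d and F can be inferred from it.
    record Factors (d : RIMetric G) (F : ℕ → ℚ) : Set where
      constructor factorsVia
      field norm≡F∘label : ∀ g → norm d g ≡ F (label g)

    metricOf-factors : ∀ {k} (w : Partition N k) → Factors (metricOf (k , w)) (ι ∘ weight w)
    metricOf-factors w = factorsVia (normMetric-norm (weight w ∘ label) (weight-isNorm w))

    labelNorm : RIMetric G → ℕ → ℚ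
    labelNorm d c = norm d (rep c)

    labelNorm-factors : ∀ d → Factors d (labelNorm d)
    labelNorm-factors d = factorsVia byRep
      where
      byRep : ∀ g → norm d g ≡ norm d (rep (label g))
      byRep g with rep-label g tt
      ... | inj₁ rep≡g   = cong (norm d) (sym rep≡g)
      ... | inj₂ rep≡g⁻¹ = trans (sym (norm-⁻¹ d g)) (cong (norm d) (sym rep≡g⁻¹))

    module _ {d F} (factors : Factors d F) where
      open IsRightInvariantMetric (proj₂ d)
      open Factors factors

      factors-rep : ∀ c → c < suc N → norm d (rep c) ≡ F c
      factors-rep c c<1+N = trans (norm≡F∘label (rep c)) (cong F (label-rep c c<1+N))

      factors-0≢suc : ∀ {y} → y < N → F 0 ≢ F (suc y)
      factors-0≢suc {y} y<N F0≡Fy = contradiction 1+y≡0 λ ()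
        where
        rep0≡e : rep 0 ≡ e
        rep0≡e = label≡0⇒e (rep 0) (label-rep 0 (s≤s z≤n))
        repy≡e : rep (suc y) ≡ e
        repy≡e = zero⇒eq (rep (suc y)) e (begin
          norm d (rep (suc y))  ≡⟨ factors-rep (suc y) (s≤s y<N) ⟩
          F (suc y)             ≡⟨ F0≡Fy ⟨
          F 0                   ≡⟨ factors-rep 0 (s≤s z≤n) ⟨
          norm d (rep 0)        ≡⟨ cong (norm d) rep0≡e ⟩
          norm d e              ≡⟨ refl-zero e ⟩
          0ℚ                    ∎)
        1+y≡0 : suc y ≡ 0
        1+y≡0 = trans (sym (label-rep (suc y) (s≤s y<N))) (trans (cong label repy≡e) label-e)

    PEquiv⇔labelKernel : ∀ {d d′ F F′} → Factors d F → Factors d′ F′ →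
                         PEquiv G d d′ ⇔ SameKernelOn (_< suc N) F F′
    PEquiv⇔labelKernel {d} {d′} {F} {F′} factors factors′ =
      ⇔-trans (PEquiv⇔sameKernel d d′) (mk⇔ onReps onAll)
      where
      open Factors using (norm≡F∘label)
      onReps : SameKernelOn U (norm d) (norm d′) → SameKernelOn (_< suc N) F F′
      onReps same c c′ c<1+N c′<1+N =
        ⇔-trans (≡-cong-⇔ (sym (factors-rep factors c c<1+N)) (sym (factors-rep factors c′ c′<1+N)))
          (⇔-trans (same (rep c) (rep c′) tt tt)
                   (≡-cong-⇔ (factors-rep factors′ c c<1+N) (factors-rep factors′ c′ c′<1+N)))
      onAll : SameKernelOn (_< suc N) F F′ → SameKernelOn U (norm d) (norm d′)
      onAll same g h _ _ =
        ⇔-trans (≡-cong-⇔ (norm≡F∘label factors g) (norm≡F∘label factors h))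
          (⇔-trans (same (label g) (label h) (label< g tt) (label< h tt))
                   (≡-cong-⇔ (sym (norm≡F∘label factors′ g)) (sym (norm≡F∘label factors′ h))))

    metricOf-injective : ∀ p q → PEquiv G (metricOf p) (metricOf q) → p ≡ q
    metricOf-injective (k , w) (l , v) P = kernel-unique w v
      (sameKernel-trans (block∼weight w) (sameKernel-trans weights (sameKernel-sym (block∼weight v))))
      where
      weights : SameKernelOn (_< N) (ι ∘ weight w ∘ suc) (ι ∘ weight v ∘ suc)
      weights = sameKernel-tail
        (Equivalence.to (PEquiv⇔labelKernel (metricOf-factors w) (metricOf-factors v)) P)

    metricOf-surjective : ∀ d → ∃ λ p → PEquiv G d (metricOf p)
    metricOf-surjective d with kernelPartition _≟ℚ_ N (labelNorm d ∘ suc)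
    ... | k , w , w∼d = (k , w) ,
      Equivalence.from (PEquiv⇔labelKernel (labelNorm-factors d) (metricOf-factors w))
        (sameKernel-cons head tail)
      where
      tail : SameKernelOn (_< N) (labelNorm d ∘ suc) (ι ∘ weight w ∘ suc)
      tail = sameKernel-trans (sameKernel-sym w∼d) (block∼weight w)
      head : ∀ {y} → y < N →
             (labelNorm d 0 ≡ labelNorm d (suc y)) ⇔ (ι (weight w 0) ≡ ι (weight w (suc y)))
      head y<N =
        absurd-⇔ (factors-0≢suc (labelNorm-factors d) y<N) (factors-0≢suc (metricOf-factors w) y<N)

    M≡Bell : M≡ G (Bell N)
    M≡Bell = metricOf ∘ to , surjective , injective
      where
      open Inverse (Bell↔Partition N)
      surjective : ∀ d → ∃ λ i → PEquiv G d (metricOf (to i))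
      surjective d with metricOf-surjective d
      ... | p , P = from p , subst (PEquiv G d ∘ metricOf) (sym (strictlyInverseˡ p)) P
      injective : ∀ i j → PEquiv G (metricOf (to i)) (metricOf (to j)) → i ≡ j
      injective i j P =
        Injection.injective (Inverse⇒Injection (Bell↔Partition N)) (metricOf-injective (to i) (to j) P)

module Modular (m : ℕ) where

  -- A record rather than a bare equation, so that a and b can be inferred from it.
  infix 4 _≈_
  record _≈_ (a b : ℕ) : Set where
    constructor mod-≡
    field ≡-mod : a % suc m ≡ b % suc m
  open _≈_

  ≈-isEquivalence : IsEquivalence _≈_
  ≈-isEquivalence = record
    { refl  = mod-≡ refl
    ; sym   = λ a≈b → mod-≡ (sym (≡-mod a≈b))
    ; trans = λ a≈b b≈c → mod-≡ (trans (≡-mod a≈b) (≡-mod b≈c))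
    }

  ≈-setoid : Setoid _ _
  ≈-setoid = record { isEquivalence = ≈-isEquivalence }

  open IsEquivalence ≈-isEquivalence public
    using () renaming (refl to ≈-refl; sym to ≈-sym; trans to ≈-trans)

  module ≈-Reasoning = Relation.Binary.Reasoning.Setoid ≈-setoid

  ≡⇒≈ : ∀ {a b} → a ≡ b → a ≈ b
  ≡⇒≈ refl = ≈-refl

  +-cong : ∀ {a b c d} → a ≈ b → c ≈ d → a + c ≈ b + d
  +-cong {a} {b} {c} {d} (mod-≡ a≈b) (mod-≡ c≈d) = mod-≡ (begin
    (a + c) % suc m                       ≡⟨ %-distribˡ-+ a c (suc m) ⟩
    (a % suc m + c % suc m) % suc m       ≡⟨ cong₂ (λ x y → (x + y) % suc m) a≈b c≈d ⟩
    (b % suc m + d % suc m) % suc m       ≡⟨ %-distribˡ-+ b d (suc m) ⟨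
    (b + d) % suc m                       ∎)
    where open ≡-Reasoning

  +-congʳ : ∀ c {a b} → a ≈ b → a + c ≈ b + c
  +-congʳ c a≈b = +-cong a≈b ≈-refl

  +-congˡ : ∀ a {c d} → c ≈ d → a + c ≈ a + d
  +-congˡ a c≈d = +-cong (≈-refl {a}) c≈d

  *-congˡ : ∀ x {a b} → a ≈ b → x * a ≈ x * b
  *-congˡ x {a} {b} (mod-≡ a≈b) = mod-≡ (begin
    (x * a) % suc m                       ≡⟨ %-distribˡ-* x a (suc m) ⟩
    (x % suc m * (a % suc m)) % suc m     ≡⟨ cong (λ y → (x % suc m * y) % suc m) a≈b ⟩
    (x % suc m * (b % suc m)) % suc m     ≡⟨ %-distribˡ-* x b (suc m) ⟨
    (x * b) % suc m                       ∎)
    where open ≡-Reasoning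

  %-≈ : ∀ a → a % suc m ≈ a
  %-≈ a = mod-≡ (m%n%n≡m%n a (suc m))

  toℕ-mod : ∀ a → toℕ (a mod suc m) ≡ a % suc m
  toℕ-mod a = toℕ-fromℕ< (m%n<n a (suc m))

  toℕ-mod-≈ : ∀ a → toℕ (a mod suc m) ≈ a
  toℕ-mod-≈ a = ≈-trans (≡⇒≈ (toℕ-mod a)) (%-≈ a)

  +-multiple : ∀ a t → a + suc m * t ≈ a
  +-multiple a t =
    mod-≡ (trans (cong (λ x → (a + x) % suc m) (*-comm (suc m) t)) ([m+kn]%n≡m%n a t (suc m)))

  ≈⇒≡ : ∀ {a b} → a < suc m → b < suc m → a ≈ b → a ≡ b
  ≈⇒≡ a<M b<M (mod-≡ a≈b) = trans (sym (m<n⇒m%n≡m a<M)) (trans a≈b (m<n⇒m%n≡m b<M))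

  +-cancelʳ-≈ : ∀ a b z → a + z ≈ b + z → a ≈ b
  +-cancelʳ-≈ a b z a+z≈b+z = begin
    a                    ≈⟨ +-multiple a z ⟨
    a + suc m * z        ≡⟨ +-assoc a z (m * z) ⟨
    a + z + m * z        ≈⟨ +-congʳ (m * z) a+z≈b+z ⟩
    b + z + m * z        ≡⟨ +-assoc b z (m * z) ⟩
    b + suc m * z        ≈⟨ +-multiple b z ⟩
    b                    ∎
    where open ≈-Reasoning

  ≈toℕ⇒mod≡ : ∀ (j : Fin (suc m)) a → a ≈ toℕ j → a mod suc m ≡ j
  ≈toℕ⇒mod≡ j a a≈j = toℕ-injective (trans (toℕ-mod a) (trans (≡-mod a≈j) (m<n⇒m%n≡m (toℕ<n j))))

  ≈⇒mod≡ : ∀ {a b} → a ≈ b → a mod suc m ≡ b mod suc m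
  ≈⇒mod≡ {a} {b} a≈b = ≈toℕ⇒mod≡ (b mod suc m) a (≈-trans a≈b (≈-sym (toℕ-mod-≈ b)))

  ∣⇒≈0 : ∀ {a} → suc m ∣ a → a ≈ 0
  ∣⇒≈0 {a} m+1∣a = mod-≡ (n∣m⇒m%n≡0 a (suc m) m+1∣a)

  ≈0⇒∣ : ∀ {a} → a ≈ 0 → suc m ∣ a
  ≈0⇒∣ {a} a≈0 = m%n≡0⇒n∣m a (suc m) (≡-mod a≈0)

  -- m ≡ -1, so (m * a) % suc m is the residue of -a.
  m*a+a≈0 : ∀ a → m * a + a ≈ 0
  m*a+a≈0 a = ≈-trans (≡⇒≈ (+-comm (m * a) a)) (+-multiple 0 a)

  neg-≈ : ∀ a → (m * a) % suc m + a ≈ 0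
  neg-≈ a = ≈-trans (+-congʳ a (%-≈ (m * a))) (m*a+a≈0 a)

  neg²≈1 : ∀ x → m * (m * x) ≈ x
  neg²≈1 x = +-cancelʳ-≈ (m * (m * x)) x (m * x) (begin
    m * (m * x) + m * x  ≈⟨ m*a+a≈0 (m * x) ⟩
    0                    ≈⟨ m*a+a≈0 x ⟨
    m * x + x            ≡⟨ +-comm (m * x) x ⟩
    x + m * x            ∎)
    where open ≈-Reasoning

  neg-cancels : ∀ a → suc m ∣ (m * a) % suc m + a
  neg-cancels a = ≈0⇒∣ (neg-≈ a)

  neg-unique : ∀ a t → t < suc m → suc m ∣ t + a → (m * a) % suc m ≡ t
  neg-unique a t t<M m+1∣t+a =
    ≈⇒≡ (m%n<n (m * a) (suc m)) t<M (+-cancelʳ-≈ _ t a (≈-trans (neg-≈ a) (≈-sym (∣⇒≈0 m+1∣t+a))))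

  transfer-neg : ∀ {σ a : ℕ → ℕ} {K} → Orbits (_< suc m) σ K → (∀ i → i < suc m → suc m ∣ σ i + a i) →
                 Orbits (_< suc m) (λ i → (m * a i) % suc m) K
  transfer-neg {σ} {a} O cancels =
    transfer O (λ i i<M → sym (neg-unique (a i) (σ i) (Orbits.σ-closed O i i<M) (cancels i i<M)))

isGroup-≡ : {A : Set} {_∙_ : A → A → A} {e : A} {_⁻¹ : A → A} →
            (∀ x y z → (x ∙ y) ∙ z ≡ x ∙ (y ∙ z)) → (∀ x → e ∙ x ≡ x) → (∀ x → x ∙ e ≡ x) →
            (∀ x → (x ⁻¹) ∙ x ≡ e) → (∀ x → x ∙ (x ⁻¹) ≡ e) → IsGroup _≡_ _∙_ e _⁻¹
isGroup-≡ {_∙_ = _∙_} {_⁻¹ = _⁻¹} assoc identityˡ identityʳ inverseˡ inverseʳ = record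
  { isMonoid = record
    { isSemigroup = record
      { isMagma = record { isEquivalence = isEquivalence ; ∙-cong = cong₂ _∙_ }
      ; assoc   = assoc
      }
    ; identity = identityˡ , identityʳ
    }
  ; inverse = inverseˡ , inverseʳ
  ; ⁻¹-cong = cong _⁻¹
  }

module MetacyclicGroup (m r c : ℕ) (r²≈1 : ∀ x → Modular._≈_ m (r * (r * x)) x)
                       (rc≈c : Modular._≈_ m (r * c) c) where

  open Modular m
  open GroupData (MC m r c) renaming (_∙_ to infixl 7 _∙_)
  open ≈-Reasoning

  twist : Bool → ℕ → ℕ
  twist s j = if s then r * j else j

  carry : Bool → Bool → ℕ
  carry s t = if s ∧ t then c else 0

  -- (x^i)⁻¹ = x^(-i) and (x^i y)⁻¹ = x^(-r(i+c)) y, with -a computed as m * a.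
  infix 8 _⁻¹
  _⁻¹ : MCElt m → MCElt m
  (i , false) ⁻¹ = (m * toℕ i) mod suc m , false
  (i , true)  ⁻¹ = (m * (r * (toℕ i + c))) mod suc m , true

  identityˡ : ∀ x → e ∙ x ≡ x
  identityˡ (j , t) = cong (_, t) (≈toℕ⇒mod≡ j _ (≡⇒≈ (+-identityʳ (toℕ j))))

  identityʳ : ∀ x → x ∙ e ≡ x
  identityʳ (i , false) = cong (_, false) (≈toℕ⇒mod≡ i _ (≡⇒≈ (trans (+-identityʳ _) (+-identityʳ _))))
  identityʳ (i , true)  = cong (_, true) (≈toℕ⇒mod≡ i _ (≡⇒≈ (ring r (toℕ i))))
    where
    ring : ∀ r i → i + r * 0 + 0 ≡ i
    ring = solve-∀

  inverseˡ : ∀ x → x ⁻¹ ∙ x ≡ e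
  inverseˡ (i , false) = cong (_, false) (≈toℕ⇒mod≡ 0F _ (begin
    toℕ ((m * toℕ i) mod suc m) + toℕ i + 0     ≈⟨ +-congʳ 0 (+-congʳ (toℕ i) (toℕ-mod-≈ _)) ⟩
    m * toℕ i + toℕ i + 0                       ≡⟨ ring m (toℕ i) ⟩
    suc m * toℕ i                               ≈⟨ +-multiple 0 (toℕ i) ⟩
    0                                           ∎))
    where
    ring : ∀ m i → m * i + i + 0 ≡ suc m * i
    ring = solve-∀
  inverseˡ (i , true) = cong (_, false) (≈toℕ⇒mod≡ 0F _ (begin
    toℕ ((m * (r * (toℕ i + c))) mod suc m) + r * toℕ i + c
      ≈⟨ +-congʳ c (+-congʳ (r * toℕ i) (toℕ-mod-≈ _)) ⟩
    m * (r * (toℕ i + c)) + r * toℕ i + c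
      ≡⟨ ring₁ m r c (toℕ i) ⟩
    m * (r * toℕ i) + m * (r * c) + r * toℕ i + c
      ≈⟨ +-congʳ c (+-congʳ (r * toℕ i) (+-congˡ (m * (r * toℕ i)) (*-congˡ m rc≈c))) ⟩
    m * (r * toℕ i) + m * c + r * toℕ i + c
      ≡⟨ ring₂ m r c (toℕ i) ⟩
    suc m * (r * toℕ i + c)
      ≈⟨ +-multiple 0 (r * toℕ i + c) ⟩
    0 ∎))
    where
    ring₁ : ∀ m r c i → m * (r * (i + c)) + r * i + c ≡ m * (r * i) + m * (r * c) + r * i + c
    ring₁ = solve-∀
    ring₂ : ∀ m r c i → m * (r * i) + m * c + r * i + c ≡ suc m * (r * i + c)
    ring₂ = solve-∀

  inverseʳ : ∀ x → x ∙ x ⁻¹ ≡ e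
  inverseʳ (i , false) = cong (_, false) (≈toℕ⇒mod≡ 0F _ (begin
    toℕ i + toℕ ((m * toℕ i) mod suc m) + 0     ≈⟨ +-congʳ 0 (+-congˡ (toℕ i) (toℕ-mod-≈ _)) ⟩
    toℕ i + m * toℕ i + 0                       ≡⟨ +-identityʳ _ ⟩
    suc m * toℕ i                               ≈⟨ +-multiple 0 (toℕ i) ⟩
    0                                           ∎))
  inverseʳ (i , true) = cong (_, false) (≈toℕ⇒mod≡ 0F _ (begin
    toℕ i + r * toℕ ((m * (r * (toℕ i + c))) mod suc m) + c
      ≈⟨ +-congʳ c (+-congˡ (toℕ i) (*-congˡ r (toℕ-mod-≈ _))) ⟩
    toℕ i + r * (m * (r * (toℕ i + c))) + c
      ≡⟨ ring₁ m r c (toℕ i) ⟩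
    toℕ i + m * (r * (r * (toℕ i + c))) + c
      ≈⟨ +-congʳ c (+-congˡ (toℕ i) (*-congˡ m (r²≈1 _))) ⟩
    toℕ i + m * (toℕ i + c) + c
      ≡⟨ ring₂ m c (toℕ i) ⟩
    suc m * (toℕ i + c)
      ≈⟨ +-multiple 0 (toℕ i + c) ⟩
    0 ∎))
    where
    ring₁ : ∀ m r c i → i + r * (m * (r * (i + c))) + c ≡ i + m * (r * (r * (i + c))) + c
    ring₁ = solve-∀
    ring₂ : ∀ m c i → i + m * (i + c) + c ≡ suc m * (i + c)
    ring₂ = solve-∀

  twist-cong : ∀ s {a b} → a ≈ b → twist s a ≈ twist s b
  twist-cong false a≈b = a≈b
  twist-cong true  a≈b = *-congˡ r a≈b

  exponent-assoc : ∀ s t u i j k →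
    i + twist s j + carry s t + twist (s xor t) k + carry (s xor t) u
      ≈ i + twist s (j + twist t k + carry t u) + carry s (t xor u)
  exponent-assoc false false u i j k = ≡⇒≈ (ring i j k)
    where
    ring : ∀ i j k → i + j + 0 + k + 0 ≡ i + (j + k + 0) + 0
    ring = solve-∀
  exponent-assoc false true u i j k = ≡⇒≈ (ring i j k r (carry true u))
    where
    ring : ∀ i j k r x → i + j + 0 + r * k + x ≡ i + (j + r * k + x) + 0
    ring = solve-∀
  exponent-assoc true false u i j k = ≡⇒≈ (ring i j k r (carry true u))
    where
    ring : ∀ i j k r x → i + r * j + 0 + r * k + x ≡ i + r * (j + k + 0) + x
    ring = solve-∀
  exponent-assoc true true false i j k = ≈-sym (begin
    i + r * (j + r * k + 0) + c    ≡⟨ ring i j k r c ⟩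
    i + r * j + r * (r * k) + c    ≈⟨ +-congʳ c (+-congˡ (i + r * j) (r²≈1 k)) ⟩
    i + r * j + k + c              ≡⟨ ring′ i j k r c ⟩
    i + r * j + c + k + 0          ∎)
    where
    ring : ∀ i j k r c → i + r * (j + r * k + 0) + c ≡ i + r * j + r * (r * k) + c
    ring = solve-∀
    ring′ : ∀ i j k r c → i + r * j + k + c ≡ i + r * j + c + k + 0
    ring′ = solve-∀
  exponent-assoc true true true i j k = ≈-sym (begin
    i + r * (j + r * k + c) + 0    ≡⟨ ring i j k r c ⟩
    i + r * j + r * (r * k) + r * c ≈⟨ +-cong (+-congˡ (i + r * j) (r²≈1 k)) rc≈c ⟩
    i + r * j + k + c              ≡⟨ ring′ i j k r c ⟩
    i + r * j + c + k + 0          ∎)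
    where
    ring : ∀ i j k r c → i + r * (j + r * k + c) + 0 ≡ i + r * j + r * (r * k) + r * c
    ring = solve-∀
    ring′ : ∀ i j k r c → i + r * j + k + c ≡ i + r * j + c + k + 0
    ring′ = solve-∀

  assoc : ∀ x y z → (x ∙ y) ∙ z ≡ x ∙ (y ∙ z)
  assoc (i , s) (j , t) (k , u) = cong₂ _,_ (≈⇒mod≡ (begin
    toℕ (ij mod suc m) + twist (s xor t) (toℕ k) + carry (s xor t) u
      ≈⟨ +-congʳ (carry (s xor t) u) (+-congʳ (twist (s xor t) (toℕ k)) (toℕ-mod-≈ ij)) ⟩
    ij + twist (s xor t) (toℕ k) + carry (s xor t) u
      ≈⟨ exponent-assoc s t u (toℕ i) (toℕ j) (toℕ k) ⟩
    toℕ i + twist s jk + carry s (t xor u)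
      ≈⟨ +-congʳ (carry s (t xor u)) (+-congˡ (toℕ i) (twist-cong s (toℕ-mod-≈ jk))) ⟨
    toℕ i + twist s (toℕ (jk mod suc m)) + carry s (t xor u)
      ∎)) (xor-assoc s t u)
    where
    ij = toℕ i + twist s (toℕ j) + carry s t
    jk = toℕ j + twist t (toℕ k) + carry t u

  isGroup : IsGroup _≡_ _∙_ e _⁻¹
  isGroup = isGroup-≡ assoc identityˡ identityʳ inverseˡ inverseʳ

negation-orbits : ∀ L H → L ≡ H + H ⊎ suc L ≡ H + H →
                  Σ (Orbits (_< suc L) (λ i → (L * i) % suc L) (suc H)) λ O →
                    (∀ i → Orbits.label O i ≡ 0 → i ≡ 0) × Orbits.label O 0 ≡ 0
negation-orbits L H L≈2H = Modular.transfer-neg L halves cancels , label≡0⇒≡0 , refl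
  where
  halves : Orbits (_< 1 + L) (concat 1 (λ i → i) (λ i → L ∸ suc i)) (1 + H)
  halves = concat-orbits (identity-orbits 1) (mirror-orbits L H L≈2H)
  label≡0⇒≡0 : ∀ i → Orbits.label halves i ≡ 0 → i ≡ 0
  label≡0⇒≡0 zero    _ = refl
  label≡0⇒≡0 (suc i) ()
  cancels : ∀ i → i < suc L → suc L ∣ concat 1 (λ i → i) (λ i → L ∸ suc i) i + i
  cancels zero    _         = divides 0 refl
  cancels (suc j) (s<s j<L) = divides 1 (begin
    suc (L ∸ suc j) + suc j   ≡⟨ cong suc (+-comm (L ∸ suc j) (suc j)) ⟩
    suc (suc j + (L ∸ suc j)) ≡⟨ cong suc (m+[n∸m]≡n j<L) ⟩
    suc L                     ≡⟨ +-identityʳ (suc L) ⟨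
    1 * suc L                 ∎)
    where open ≡-Reasoning

module MetacyclicOrbits {m r c : ℕ} (r²≈1 : ∀ x → Modular._≈_ m (r * (r * x)) x)
  (rc≈c : Modular._≈_ m (r * c) c) {H R : ℕ}
  (rotations : Orbits (_< suc m) (λ i → (m * i) % suc m) (suc H))
  (rotation-label≡0 : ∀ i → Orbits.label rotations i ≡ 0 → i ≡ 0)
  (rotation-label-0 : Orbits.label rotations 0 ≡ 0)
  (reflections : Orbits (_< suc m) (λ i → (m * (r * (i + c))) % suc m) R) where

  open Modular m
  open MetacyclicGroup m r c r²≈1 rc≈c
  open GroupData (MC m r c)
  module Rot = Orbits rotations
  module Ref = Orbits reflections

  label : MCElt m → ℕ
  label (i , false) = Rot.label (toℕ i)
  label (i , true)  = suc H + Ref.label (toℕ i)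

  rep : ℕ → MCElt m
  rep c with split (suc H) c
  ... | below _ = Rot.rep c mod suc m , false
  ... | above j = Ref.rep j mod suc m , true

  toℕ-mod-< : ∀ {a} → a < suc m → toℕ (a mod suc m) ≡ a
  toℕ-mod-< {a} a<M = trans (toℕ-mod a) (m<n⇒m%n≡m a<M)

  mod-rep-label : ∀ {x} (i : Fin (suc m)) y →
                  x ≡ toℕ i ⊎ x ≡ y % suc m → x mod suc m ≡ i ⊎ x mod suc m ≡ y mod suc m
  mod-rep-label i y =
    Sum.map (λ x≡i → ≈toℕ⇒mod≡ i _ (≡⇒≈ x≡i)) (λ x≡y → ≈⇒mod≡ (≈-trans (≡⇒≈ x≡y) (%-≈ y)))

  label< : ∀ x → U x → label x < suc H + R
  label< (i , false) _ = ≤-trans (Rot.label< (toℕ i) (toℕ<n i)) (m≤m+n (suc H) R)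
  label< (i , true)  _ = +-monoʳ-< (suc H) (Ref.label< (toℕ i) (toℕ<n i))

  label-⁻¹ : ∀ x → U x → label (x ⁻¹) ≡ label x
  label-⁻¹ (i , false) _ = trans (cong Rot.label (toℕ-mod (m * toℕ i))) (Rot.label-σ (toℕ i) (toℕ<n i))
  label-⁻¹ (i , true)  _ = cong (suc H +_)
    (trans (cong Ref.label (toℕ-mod (m * (r * (toℕ i + c))))) (Ref.label-σ (toℕ i) (toℕ<n i)))

  label-rep : ∀ c → c < suc H + R → label (rep c) ≡ c
  label-rep c c<1+H+R with split (suc H) c
  ... | below c<1+H = trans (cong Rot.label (toℕ-mod-< (Rot.rep-∈ c c<1+H))) (Rot.label-rep c c<1+H)
  ... | above j     =
    cong (suc H +_) (trans (cong Ref.label (toℕ-mod-< (Ref.rep-∈ j j<R))) (Ref.label-rep j j<R))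
    where j<R = above< (suc H) c<1+H+R

  rep-label : ∀ x → U x → rep (label x) ≡ x ⊎ rep (label x) ≡ x ⁻¹
  rep-label (i , false) _ rewrite split-below (Rot.label< (toℕ i) (toℕ<n i)) =
    Sum.map (cong (_, false)) (cong (_, false))
            (mod-rep-label i (m * toℕ i) (Rot.rep-label (toℕ i) (toℕ<n i)))
  rep-label (i , true)  _ rewrite split-above (suc H) (Ref.label (toℕ i)) =
    Sum.map (cong (_, true)) (cong (_, true))
            (mod-rep-label i (m * (r * (toℕ i + c))) (Ref.rep-label (toℕ i) (toℕ<n i)))

  inversion-orbits : Orbits U _⁻¹ (suc H + R)
  inversion-orbits = record
    { σ-closed  = λ _ _ → tt
    ; label     = label
    ; label<    = label<
    ; label-σ   = label-⁻¹
    ; rep       = rep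
    ; rep-∈     = λ _ _ → tt
    ; label-rep = label-rep
    ; rep-label = rep-label
    }

  label≡0⇒e : ∀ x → label x ≡ 0 → x ≡ e
  label≡0⇒e (i , false) label≡0 = cong (_, false) (toℕ-injective (rotation-label≡0 (toℕ i) label≡0))

  M≡Bell : M≡ (MC m r c) (Bell (H + R))
  M≡Bell = RightInvariantMetrics.Classification.M≡Bell (MC m r c) _⁻¹ isGroup
             inversion-orbits label≡0⇒e rotation-label-0

-- The involution σ describes inversion on the elements x^i y: (x^i y)⁻¹ = x^(σ i) y.
M≡Bell-metacyclic : ∀ m r c H {R σ} → (∀ x → Modular._≈_ m (r * (r * x)) x) → Modular._≈_ m (r * c) c →
                    m ≡ H + H ⊎ suc m ≡ H + H → Orbits (_< suc m) σ R →
                    (∀ i → i < suc m → suc m ∣ σ i + r * (i + c)) → M≡ (MC m r c) (Bell (H + R))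
M≡Bell-metacyclic m r c H r²≈1 rc≈c m≈2H reflections cancels with negation-orbits m H m≈2H
... | rotations , rotation-label≡0 , rotation-label-0 =
  MetacyclicOrbits.M≡Bell {m} {r} {c} r²≈1 rc≈c rotations rotation-label≡0 rotation-label-0
    (Modular.transfer-neg m reflections cancels)

M≡Bell-dihedral : ∀ m H → m ≡ H + H ⊎ suc m ≡ H + H → M≡ (MC m m 0) (Bell (H + suc m))
M≡Bell-dihedral m H m≈2H =
  M≡Bell-metacyclic m m 0 H (Modular.neg²≈1 m) (Modular.≡⇒≈ m (*-zeroʳ m)) m≈2H
    (identity-orbits (suc m)) cancels
  where
  ring : ∀ m i → i + m * (i + 0) ≡ i * suc m
  ring = solve-∀
  cancels : ∀ i → i < suc m → suc m ∣ i + m * (i + 0)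
  cancels i _ = divides i (ring m i)

M≡Bell-dicyclic : ∀ m n → suc m ≡ n + n → M≡ (MC m m n) (Bell (n + n))
M≡Bell-dicyclic m n 1+m≡2n =
  M≡Bell-metacyclic m m n n neg²≈1 mn≈n (inj₂ 1+m≡2n) halves cancels
  where
  open Modular m
  halves : Orbits (_< suc m) (halfSwap n) n
  halves = subst (λ M → Orbits (_< M) (halfSwap n) n) (sym 1+m≡2n) (halfSwap-orbits n)
  mn≈n : m * n ≈ n
  mn≈n = +-cancelʳ-≈ (m * n) n n (≈-trans (m*a+a≈0 n) (≈-sym (∣⇒≈0 (divides 1 2n≡1*M))))
    where
    2n≡1*M : n + n ≡ 1 * suc m
    2n≡1*M = trans (sym 1+m≡2n) (sym (+-identityʳ (suc m)))
  cancels : ∀ i → i < suc m → suc m ∣ halfSwap n i + m * (i + n)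
  cancels i i<1+m with split n i
  ... | below _ = divides (i + n) (ring₁ m n i)
    where
    ring₁ : ∀ m n i → n + i + m * (i + n) ≡ (i + n) * suc m
    ring₁ = solve-∀
  ... | above j = divides (j + m) (begin
    j + m * (n + j + n)      ≡⟨ ring₂ m n j ⟩
    j + m * j + m * (n + n)  ≡⟨ cong (λ x → j + m * j + m * x) 1+m≡2n ⟨
    j + m * j + m * suc m    ≡⟨ ring₃ m j ⟩
    (j + m) * suc m          ∎)
    where
    open ≡-Reasoning
    ring₂ : ∀ m n j → j + m * (n + j + n) ≡ j + m * j + m * (n + n)
    ring₂ = solve-∀
    ring₃ : ∀ m j → j + m * j + m * suc m ≡ (j + m) * suc m
    ring₃ = solve-∀

-- x has order 4Q and y x y = x^(2Q-1). On x^i y the inversion fixes i = 2h, and for i = 2h + 1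
-- it swaps the two halves of [0, 2Q) in h.
module QuasiDihedral⁻ (q : ℕ) where

  open ≡-Reasoning

  Q m r : ℕ
  Q = suc q
  m = q + Q + (Q + Q)
  r = q + Q

  r²≈1 : ∀ x → Modular._≈_ m (r * (r * x)) x
  r²≈1 x = Modular.≈-trans m (Modular.≡⇒≈ m (ring q x)) (Modular.+-multiple m x (q * x))
    where
    ring : ∀ q x → (q + suc q) * ((q + suc q) * x) ≡ x + suc (q + suc q + (suc q + suc q)) * (q * x)
    ring = solve-∀

  cancels : ∀ i → i < suc m → suc m ∣ interleave (λ h → h) (halfSwap Q) i + r * (i + 0)
  cancels i i<1+m with parity i
  ... | even h = divides h (begin
    double h + r * (double h + 0)      ≡⟨ cong (λ a → a + r * (a + 0)) (double≡+ h) ⟩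
    (h + h) + r * ((h + h) + 0)        ≡⟨ ring q h ⟩
    h * suc m                          ∎)
    where
    ring : ∀ q h → (h + h) + (q + suc q) * ((h + h) + 0) ≡ h * suc (q + suc q + (suc q + suc q))
    ring = solve-∀
  ... | odd h with split Q h
  ...   | below _ = divides (suc h) (begin
    suc (double (Q + h)) + r * (suc (double h) + 0)
      ≡⟨ cong₂ (λ a b → suc a + r * (suc b + 0)) (double≡+ (Q + h)) (double≡+ h) ⟩
    suc ((Q + h) + (Q + h)) + r * (suc (h + h) + 0)
      ≡⟨ ring q h ⟩
    suc h * suc m
      ∎)
    where
    ring : ∀ q h → suc ((suc q + h) + (suc q + h)) + (q + suc q) * (suc (h + h) + 0)
                   ≡ suc h * suc (q + suc q + (suc q + suc q))
    ring = solve-∀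
  ...   | above j = divides (j + Q) (begin
    suc (double j) + r * (suc (double (Q + j)) + 0)
      ≡⟨ cong₂ (λ a b → suc a + r * (suc b + 0)) (double≡+ j) (double≡+ (Q + j)) ⟩
    suc (j + j) + r * (suc ((Q + j) + (Q + j)) + 0)
      ≡⟨ ring q j ⟩
    (j + Q) * suc m
      ∎)
    where
    ring : ∀ q j → suc (j + j) + (q + suc q) * (suc ((suc q + j) + (suc q + j)) + 0)
                   ≡ (j + suc q) * suc (q + suc q + (suc q + suc q))
    ring = solve-∀

  M≡Bell : M≡ (MC m r 0) (Bell ((Q + Q) + ((Q + Q) + Q)))
  M≡Bell = M≡Bell-metacyclic m r 0 (Q + Q) r²≈1 (Modular.≡⇒≈ m (*-zeroʳ r)) (inj₂ refl)
    (interleave-orbits (identity-orbits (Q + Q)) (halfSwap-orbits Q)) cancels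

-- x has order 8P and y x y = x^(4P+1). On x^i y the inversion negates h modulo 4P for i = 2h,
-- and for i = 2h + 1 it mirrors h within each half of [0, 4P).
module QuasiDihedral⁺ (p : ℕ) where

  open ≡-Reasoning

  P L m r : ℕ
  P = suc p
  L = p + P + (P + P)
  m = L + suc L
  r = suc (suc L)

  r²≈1 : ∀ x → Modular._≈_ m (r * (r * x)) x
  r²≈1 x = Modular.≈-trans m (Modular.≡⇒≈ m (ring p x)) (Modular.+-multiple m x (suc (P + P) * x))
    where
    ring : ∀ p x → let l = p + suc p + (suc p + suc p) in
                   suc (suc l) * (suc (suc l) * x) ≡ x + suc (l + suc l) * (suc (suc p + suc p) * x)
    ring = solve-∀

  mirror : ℕ → ℕ
  mirror j = (P + P) ∸ suc j

  -- The side conditions Q ≡ suc h + u stand in for the truncated subtraction u = Q ∸ suc h.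
  lower-cancels : ∀ Q h u → suc h + u ≡ Q →
                  suc (u + u) + suc (Q + Q) * (suc (h + h) + 0) ≡ suc h * ((Q + Q) + (Q + Q))
  lower-cancels .(suc h + u) h u refl = ring h u
    where
    ring : ∀ h u → suc (u + u) + suc ((suc h + u) + (suc h + u)) * (suc (h + h) + 0)
                   ≡ suc h * (((suc h + u) + (suc h + u)) + ((suc h + u) + (suc h + u)))
    ring = solve-∀

  upper-cancels : ∀ Q j u → suc j + u ≡ Q →
                  suc ((Q + u) + (Q + u)) + suc (Q + Q) * (suc ((Q + j) + (Q + j)) + 0)
                    ≡ (j + Q + 2) * ((Q + Q) + (Q + Q))
  upper-cancels .(suc j + u) j u refl = ring j u
    where
    ring : ∀ j u → let Q = suc j + u in
                   suc ((Q + u) + (Q + u)) + suc (Q + Q) * (suc ((Q + j) + (Q + j)) + 0)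
                     ≡ (j + Q + 2) * ((Q + Q) + (Q + Q))
    ring = solve-∀

  cancels : ∀ i → i < suc m →
            suc m ∣ interleave (λ h → (L * h) % suc L) (concat (P + P) mirror mirror) i + r * (i + 0)
  cancels i i<1+m with parity i
  ... | even h with Modular.neg-cancels L h
  ...   | divides t v+h≡tM = divides (t + h) (begin
    double v + r * (double h + 0)
      ≡⟨ cong₂ (λ a b → a + r * (b + 0)) (double≡+ v) (double≡+ h) ⟩
    (v + v) + r * ((h + h) + 0)
      ≡⟨ ring₁ L v h ⟩
    (v + h) + (v + h) + suc L * (h + h)
      ≡⟨ cong (λ x → x + x + suc L * (h + h)) v+h≡tM ⟩
    t * suc L + t * suc L + suc L * (h + h)
      ≡⟨ ring₂ L t h ⟩
    (t + h) * suc m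
      ∎)
    where
    v = (L * h) % suc L
    ring₁ : ∀ L v h → (v + v) + suc (suc L) * ((h + h) + 0) ≡ (v + h) + (v + h) + suc L * (h + h)
    ring₁ = solve-∀
    ring₂ : ∀ L t h → t * suc L + t * suc L + suc L * (h + h) ≡ (t + h) * suc (L + suc L)
    ring₂ = solve-∀
  cancels i i<1+m | odd h with split (P + P) h
  ... | below h<2P = divides (suc h) (begin
    suc (double u) + r * (suc (double h) + 0)
      ≡⟨ cong₂ (λ a b → suc a + r * (suc b + 0)) (double≡+ u) (double≡+ h) ⟩
    suc (u + u) + r * (suc (h + h) + 0)
      ≡⟨ lower-cancels (P + P) h u (m+[n∸m]≡n h<2P) ⟩
    suc h * suc m
      ∎)
    where u = mirror h
  ... | above j = divides (j + (P + P) + 2) (begin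
    suc (double ((P + P) + u)) + r * (suc (double ((P + P) + j)) + 0)
      ≡⟨ cong₂ (λ a b → suc a + r * (suc b + 0)) (double≡+ ((P + P) + u)) (double≡+ ((P + P) + j)) ⟩
    suc (((P + P) + u) + ((P + P) + u)) + r * (suc (((P + P) + j) + ((P + P) + j)) + 0)
      ≡⟨ upper-cancels (P + P) j u (m+[n∸m]≡n (above< (P + P) (odd<⁻¹ i<1+m))) ⟩
    (j + (P + P) + 2) * suc m
      ∎)
    where u = mirror j

  M≡Bell : M≡ (MC m r 0) (Bell (suc L + (suc (P + P) + (P + P))))
  M≡Bell = M≡Bell-metacyclic m r 0 (suc L) r²≈1 (Modular.≡⇒≈ m (*-zeroʳ r)) (inj₂ refl)
    (interleave-orbits negations (concat-orbits mirrors mirrors)) cancels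
    where
    negations = proj₁ (negation-orbits L (P + P) (inj₂ refl))
    mirrors   = mirror-orbits (P + P) P (inj₁ refl)

M≡-cong : ∀ c {m m′ r r′ N N′} → m ≡ m′ → r ≡ r′ → N ≡ N′ →
          M≡ (MC m r c) (Bell N) → M≡ (MC m′ r′ c) (Bell N′)
M≡-cong c refl refl refl M≡N = M≡N

2^≡suc : ∀ n → ∃ λ q → 2 ^ n ≡ suc q
2^≡suc n = _ , sym (suc-pred (2 ^ n) {{m^n≢0 2 n}})

dihedral-odd : ∀ k → M≡ (Dihedral (2 * k + 1)) (Bell (3 * k + 1))
dihedral-odd k = subst (λ N → M≡ (Dihedral (2 * k + 1)) (Bell N))
  (trans (cong (λ x → k + suc x) m≡2k) (ring k)) (M≡Bell-dihedral m k (inj₁ m≡2k))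
  where
  m = 2 * k + 1 ∸ 1
  m≡2k : m ≡ k + k
  m≡2k = trans (m+n∸n≡m (2 * k) 1) (cong (k +_) (+-identityʳ k))
  ring : ∀ k → k + suc (k + k) ≡ 3 * k + 1
  ring = solve-∀

dihedral-even : ∀ k → 2 ≤ k → M≡ (Dihedral (2 * k)) (Bell (3 * k))
dihedral-even (suc k) _ = subst (λ N → M≡ (Dihedral (2 * suc k)) (Bell N)) (ring k)
  (M≡Bell-dihedral (2 * suc k ∸ 1) (suc k) (inj₂ (cong (suc k +_) (+-identityʳ (suc k)))))
  where
  ring : ∀ k → suc k + suc (k + (suc k + 0)) ≡ 3 * suc k
  ring = solve-∀

dicyclic : ∀ n → 2 ≤ n → M≡ (Dicyclic n) (Bell (2 * n))
dicyclic (suc n) _ = subst (λ N → M≡ (Dicyclic (suc n)) (Bell N)) (sym 2n≡n+n)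
  (M≡Bell-dicyclic (2 * suc n ∸ 1) (suc n) 2n≡n+n)
  where
  2n≡n+n : 2 * suc n ≡ suc n + suc n
  2n≡n+n = cong (suc n +_) (+-identityʳ (suc n))

quasiDihedral⁻ : ∀ n → 4 ≤ n → M≡ (QuasiDihedral⁻ n) (Bell (5 * 2 ^ (n ∸ 3)))
quasiDihedral⁻ 1 (s≤s ())
quasiDihedral⁻ 2 (s≤s (s≤s ()))
quasiDihedral⁻ (suc (suc (suc n))) _ with 2^≡suc n
... | q , 2^n≡1+q rewrite 2^n≡1+q =
  M≡-cong 0 (cong (_∸ 1) (ring₁ q)) (cong (_∸ 1) (ring₂ q)) (ring₃ q) (QuasiDihedral⁻.M≡Bell q)
  where
  ring₁ : ∀ q → suc (q + suc q + (suc q + suc q)) ≡ 2 * (2 * suc q)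
  ring₁ = solve-∀
  ring₂ : ∀ q → suc (q + suc q) ≡ 2 * suc q
  ring₂ = solve-∀
  ring₃ : ∀ q → (suc q + suc q) + ((suc q + suc q) + suc q) ≡ 5 * suc q
  ring₃ = solve-∀

quasiDihedral⁺ : ∀ n → 4 ≤ n → M≡ (QuasiDihedral⁺ n) (Bell (2 ^ (n ∸ 1) + 1))
quasiDihedral⁺ 1 (s≤s ())
quasiDihedral⁺ 2 (s≤s (s≤s ()))
quasiDihedral⁺ 3 (s≤s (s≤s (s≤s ())))
quasiDihedral⁺ (suc (suc (suc (suc n)))) _ with 2^≡suc n
... | p , 2^n≡1+p rewrite 2^n≡1+p =
  M≡-cong 0 (cong (_∸ 1) (ring₁ p)) (ring₂ p) (ring₃ p) (QuasiDihedral⁺.M≡Bell p)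
  where
  ring₁ : ∀ p → let l = p + suc p + (suc p + suc p) in suc (l + suc l) ≡ 2 * (2 * (2 * suc p))
  ring₁ = solve-∀
  ring₂ : ∀ p → let l = p + suc p + (suc p + suc p) in suc (suc l) ≡ 2 * (2 * suc p) + 1
  ring₂ = solve-∀
  ring₃ : ∀ p → let l = p + suc p + (suc p + suc p) in
                suc l + (suc (suc p + suc p) + (suc p + suc p)) ≡ 2 * (2 * (2 * suc p)) + 1
  ring₃ = solve-∀

proposition5p5 :
    ((k : ℕ) → 1 ≤ k → M≡ (Dihedral (2 * k + 1)) (Bell (3 * k + 1)))
    × ((k : ℕ) → 2 ≤ k → M≡ (Dihedral (2 * k)) (Bell (3 * k)))
    × ((n : ℕ) → 2 ≤ n → M≡ (Dicyclic n) (Bell (2 * n)))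
    × ((n : ℕ) → 4 ≤ n → M≡ (QuasiDihedral⁻ n) (Bell (5 * 2 ^ (n ∸ 3))))
    × ((n : ℕ) → 4 ≤ n → M≡ (QuasiDihedral⁺ n) (Bell (2 ^ (n ∸ 1) + 1)))
proposition5p5 = (λ k _ → dihedral-odd k) , dihedral-even , dicyclic , quasiDihedral⁻ , quasiDihedral⁺
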